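{- Let $p\ge 0$ be an integer. Let $b_1,\dots,b_k$ be positive integers with $\gcd(b_1,\dots,b_k)=1$ forming the minimal generator system of the numerical semigroup $\langle b_1,\dots,b_k\rangle=\{\sum_{i=1}^k b_ix_i: x_i\in\mathbb N_0\}$ (i.e. no $b_i$ is a non-negative integer combination of the others). Let $\alpha$ be a positive integer with $\alpha\in\langle b_1,\dots,b_k\rangle$ and $\alpha\ne b_i$ for $i=1,\dots,k$, and let $\beta$ be a positive integer with $\gcd(\alpha,\beta)=1$. Then $$g_p(\alpha,\beta b_1,\dots,\beta b_k)=\beta\, g_p(\alpha,b_1,\dots,b_k)+(\beta-1)\alpha,$$ $$n_p(\alpha,\beta b_1,\dots,\beta b_k)=\beta\, n_p(\alpha,b_1,\dots,b_k)+\frac{(\alpha-1)(\beta-1)}{2}.$$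
   Context: For a finite list $A=(a_1,\dots,a_m)$ of positive integers with $\gcd(A)=1$ and an integer $n\ge 0$, the denumerant $d(n;A)$ is the number of tuples $(x_1,\dots,x_m)\in\mathbb N_0^m$ with $a_1x_1+\dots+a_mx_m=n$; representations are counted with respect to every entry of the list, even if some entry is redundant as a generator (e.g. $\alpha$ above). For $p\ge 0$, $S_p(A)=\{n\in\mathbb N_0: d(n;A)>p\}$ and $G_p(A)=\mathbb N_0\setminus S_p(A)$ (a finite set). The $p$-Frobenius number is $g_p(A)=\max G_p(A)$ and the $p$-genus is $n_p(A)=\#G_p(A)$. -}

module Defs where

open import Data.Nat using (ℕ; zero; suc; _+_; _*_; _≤_; _<_; _≤?_; _≟_)
open import Data.Nat.GCD using (gcd)
open import Data.Integer using (ℤ; +_; -[1+_]) renaming (_≤_ to _≤ℤ_)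
open import Data.List using (List; []; _∷_; length; filter; upTo; concatMap; map)
open import Data.Vec using (Vec; []; _∷_; foldr)
open import Data.Product using (Σ; ∃; _×_; _,_)
open import Data.Sum using (_⊎_)
open import Relation.Binary.PropositionalEquality using (_≡_)

dot : ∀ {m} → Vec ℕ m → Vec ℕ m → ℕ
dot []       []       = 0
dot (a ∷ as) (x ∷ xs) = a * x + dot as xs

tuples : (m n : ℕ) → List (Vec ℕ m)
tuples zero    n = [] ∷ []
tuples (suc m) n = concatMap (λ x → map (x ∷_) (tuples m n)) (upTo (suc n))

-- denumerant d(n;A): number of x ∈ ℕ₀^m with a₁x₁+…+aₘxₘ = n.
-- (For positive entries aᵢ every solution has xᵢ ≤ n, so enumerating
--  the tuples with entries ≤ n counts all solutions.)
d : ℕ → ∀ {m} → Vec ℕ m → ℕ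
d n {m} A = length (filter (λ x → dot A x ≟ n) (tuples m n))

gcdVec : ∀ {m} → Vec ℕ m → ℕ
gcdVec = foldr _ gcd 0

InSemigroup : ℕ → ∀ {m} → Vec ℕ m → Set
InSemigroup n {m} A = Σ (Vec ℕ m) λ x → dot A x ≡ n

-- g is the p-Frobenius number g_p(A) = max G_p(A), G_p(A) = {n | d(n;A) ≤ p},
-- with the convention g_p(A) = -1 when G_p(A) is empty.
IsPFrobenius : ℕ → ∀ {m} → Vec ℕ m → ℤ → Set
IsPFrobenius p A g =
  (∀ (n : ℕ) → d n A ≤ p → (+ n) ≤ℤ g) ×
  ((g ≡ -[1+ 0 ]) ⊎ (Σ ℕ λ n → (g ≡ + n) × (d n A ≤ p)))

-- c is the p-genus n_p(A) = #G_p(A): for some bound B beyond which d(n;A) > p,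
-- c is the number of n < B with d(n;A) ≤ p.
IsPGenus : ℕ → ∀ {m} → Vec ℕ m → ℕ → Set
IsPGenus p A c =
  Σ ℕ λ B → (∀ (n : ℕ) → B ≤ n → p < d n A) ×
            (c ≡ length (filter (λ n → d n A ≤? p) (upTo B)))

-- Since gcd(α, β) = 1, every n ∈ ℕ is uniquely α r + β N with 0 ≤ r < β and N ∈ ℤ. In any
-- representation n = α x + β (b₁ y₁ + … + bₖ yₖ) we have x ≡ r (mod β), so writing x = r + β t
-- the solutions correspond to the representations of N by (α, b₁, …, bₖ): d(n; α, βb) = d(N; α, b)
-- when N ≥ 0, and d(n; α, βb) = 0 when N < 0, i.e. when n is a gap of ⟨α, β⟩. So G_p(α, βb) is the
-- set of gaps of ⟨α, β⟩ together with the sets α r + β G_p(α, b), r < β. Its maximum is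
-- α (β − 1) + β g_p(α, b); counting it residue class by residue class modulo β gives β n_p(α, b)
-- plus the number of gaps of ⟨α, β⟩, which is Σ_{r<β} ⌊α r / β⌋ = (α − 1)(β − 1)/2.
module Submission where

open import Defs
open import Data.Bool using (true; false)
open import Data.Fin using (Fin)
open import Data.List as List using (List; []; _∷_; length; filter; upTo; concatMap; [_])
open import Data.List.Properties using (length-++; filter-++; filter-none; filter-≐; concatMap-++; concatMap-pure; upTo-∷ʳ; ++-identityʳ)
import Data.List.Relation.Unary.All as ListAll
open import Data.Nat using (ℕ; zero; suc; _+_; _*_; _∸_; _/_; _%_; _<_; _≤_; z≤n; s≤s; z<s; NonZero; >-nonZero; >-nonZero⁻¹)
open import Data.Nat.Coprimality as Coprime using (Coprime; coprime-Bézout; coprime-divisor; gcd≡1⇒coprime)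
open import Data.Nat.DivMod using (m≡m%n+[m/n]*n; m%n<n; [m+kn]%n≡m%n; %-congˡ; m<n⇒m%n≡m; m<n*o⇒m/o<n; m*n/n≡m; /-congˡ; 0/n≡0; m<n⇒m/n≡0; +-distrib-/-∣ʳ)
open import Data.Nat.Divisibility using (_∣_; _∣0; divides; ∣⇒≤; ∣m+n∣m⇒∣n; m∣m*n; n∣m*n; ∣m⇒∣m*n; ∣m∸n∣n⇒∣m)
open import Data.Nat.GCD using (gcd; module Bézout)
open import Data.Nat.Properties
open import Data.Nat.Tactic.RingSolver using (solve-∀)
open import Data.Product as Product using (Σ; ∃-syntax; _×_; _,_; proj₁; proj₂)
open import Data.Sum using (_⊎_; inj₁; inj₂)
open import Data.Vec using (Vec; []; _∷_; map; lookup; removeAt)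
open import Data.Vec.Relation.Unary.All as All using (All; []; _∷_)
import Data.Vec.Relation.Unary.All.Properties as All
open import Function using (_∘_; case_of_)
open import Relation.Binary.PropositionalEquality hiding ([_])
open import Relation.Nullary using (¬_; Dec; yes; no; does; contradiction)
open import Relation.Unary using (Pred; Decidable)

∑< : ℕ → (ℕ → ℕ) → ℕ
∑< zero    f = 0
∑< (suc n) f = ∑< n f + f n

syntax ∑< n (λ i → e) = ∑[ i < n ] e

∑-cong : ∀ n {f g : ℕ → ℕ} → (∀ i → i < n → f i ≡ g i) → ∑< n f ≡ ∑< n g
∑-cong zero    f≗g = refl
∑-cong (suc n) f≗g = cong₂ _+_ (∑-cong n (λ i i<n → f≗g i (m<n⇒m<1+n i<n))) (f≗g n ≤-refl)

∑-const : ∀ n c → ∑[ _ < n ] c ≡ n * c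
∑-const zero    c = refl
∑-const (suc n) c = trans (cong (_+ c) (∑-const n c)) (+-comm (n * c) c)

∑-zero : ∀ n {f : ℕ → ℕ} → (∀ i → i < n → f i ≡ 0) → ∑< n f ≡ 0
∑-zero n {f} f≡0 = begin
  ∑< n f          ≡⟨ ∑-cong n f≡0 ⟩
  ∑[ _ < n ] 0    ≡⟨ ∑-const n 0 ⟩
  n * 0           ≡⟨ *-zeroʳ n ⟩
  0               ∎
  where open ≡-Reasoning

∑-++ : ∀ m n (f : ℕ → ℕ) → ∑< (m + n) f ≡ ∑< m f + ∑[ j < n ] f (m + j)
∑-++ m zero    f = trans (cong (λ l → ∑< l f) (+-identityʳ m)) (sym (+-identityʳ _))
∑-++ m (suc n) f = begin
  ∑< (m + suc n) f                                    ≡⟨ cong (λ l → ∑< l f) (+-suc m n) ⟩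
  ∑< (m + n) f + f (m + n)                            ≡⟨ cong (_+ f (m + n)) (∑-++ m n f) ⟩
  ∑< m f + ∑[ j < n ] f (m + j) + f (m + n)           ≡⟨ +-assoc (∑< m f) _ _ ⟩
  ∑< m f + (∑[ j < n ] f (m + j) + f (m + n))         ∎
  where open ≡-Reasoning

∑-vanishing-tail : ∀ {m n} {f : ℕ → ℕ} → m ≤ n → (∀ i → m ≤ i → i < n → f i ≡ 0) → ∑< n f ≡ ∑< m f
∑-vanishing-tail {m} {n} {f} m≤n tail≡0 = begin
  ∑< n f                                  ≡⟨ cong (λ l → ∑< l f) (sym (m+[n∸m]≡n m≤n)) ⟩
  ∑< (m + (n ∸ m)) f                      ≡⟨ ∑-++ m (n ∸ m) f ⟩
  ∑< m f + ∑[ j < n ∸ m ] f (m + j)       ≡⟨ cong (∑< m f +_) (∑-zero (n ∸ m) λ j j<n∸m → tail≡0 (m + j) (m≤m+n m j) (m+j<n j j<n∸m)) ⟩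
  ∑< m f + 0                              ≡⟨ +-identityʳ _ ⟩
  ∑< m f                                  ∎
  where
  open ≡-Reasoning
  m+j<n : ∀ j → j < n ∸ m → m + j < n
  m+j<n j j<n∸m = subst (m + j <_) (m+[n∸m]≡n m≤n) (+-monoʳ-< m j<n∸m)

∑-single : ∀ n r {f : ℕ → ℕ} → r < n → (∀ i → i < n → i ≢ r → f i ≡ 0) → ∑< n f ≡ f r
∑-single (suc n) r {f} r<1+n others≡0 with r ≟ n
... | yes refl = cong (_+ f r) (∑-zero n (λ i i<n → others≡0 i (m<n⇒m<1+n i<n) (<⇒≢ i<n)))
... | no r≢n   = begin
  ∑< n f + f n   ≡⟨ cong₂ _+_ (∑-single n r (≤∧≢⇒< (≤-pred r<1+n) r≢n) (λ i i<n → others≡0 i (m<n⇒m<1+n i<n))) (others≡0 n ≤-refl (r≢n ∘ sym)) ⟩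
  f r + 0        ≡⟨ +-identityʳ (f r) ⟩
  f r            ∎
  where open ≡-Reasoning

∑-distrib-+ : ∀ n (f g : ℕ → ℕ) → ∑[ i < n ] (f i + g i) ≡ ∑< n f + ∑< n g
∑-distrib-+ zero    f g = refl
∑-distrib-+ (suc n) f g = begin
  ∑[ i < n ] (f i + g i) + (f n + g n)    ≡⟨ cong (_+ (f n + g n)) (∑-distrib-+ n f g) ⟩
  ∑< n f + ∑< n g + (f n + g n)           ≡⟨ +-assoc (∑< n f) _ _ ⟩
  ∑< n f + (∑< n g + (f n + g n))         ≡⟨ cong (∑< n f +_) (x+[y+z]≡y+[x+z] (∑< n g) (f n) (g n)) ⟩
  ∑< n f + (f n + (∑< n g + g n))         ≡⟨ +-assoc (∑< n f) _ _ ⟨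
  ∑< n f + f n + (∑< n g + g n)           ∎
  where
  open ≡-Reasoning
  x+[y+z]≡y+[x+z] : ∀ x y z → x + (y + z) ≡ y + (x + z)
  x+[y+z]≡y+[x+z] x y z = trans (sym (+-assoc x y z)) (trans (cong (_+ z) (+-comm x y)) (+-assoc y x z))

∑-distribʳ-* : ∀ n (f : ℕ → ℕ) c → ∑< n f * c ≡ ∑[ i < n ] (f i * c)
∑-distribʳ-* zero    f c = refl
∑-distribʳ-* (suc n) f c = trans (*-distribʳ-+ c (∑< n f) (f n)) (cong (_+ f n * c) (∑-distribʳ-* n f c))

∑-comm : ∀ m n (f : ℕ → ℕ → ℕ) → ∑[ i < m ] ∑[ j < n ] f i j ≡ ∑[ j < n ] ∑[ i < m ] f i j
∑-comm zero    n f = sym (∑-zero n (λ _ _ → refl))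
∑-comm (suc m) n f = trans (cong (_+ ∑< n (f m)) (∑-comm m n f)) (sym (∑-distrib-+ n _ (f m)))

∑-blocks : ∀ b m (f : ℕ → ℕ) → ∑< (b * m) f ≡ ∑[ q < m ] ∑[ j < b ] f (b * q + j)
∑-blocks b zero    f = cong (λ l → ∑< l f) (*-zeroʳ b)
∑-blocks b (suc m) f = begin
  ∑< (b * suc m) f                                 ≡⟨ cong (λ l → ∑< l f) (trans (*-suc b m) (+-comm b (b * m))) ⟩
  ∑< (b * m + b) f                                 ≡⟨ ∑-++ (b * m) b f ⟩
  ∑< (b * m) f + ∑[ j < b ] f (b * m + j)          ≡⟨ cong (_+ ∑[ j < b ] f (b * m + j)) (∑-blocks b m f) ⟩
  ∑[ q < m ] ∑[ j < b ] f (b * q + j) + ∑[ j < b ] f (b * m + j)  ∎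
  where open ≡-Reasoning

∑-reverse : ∀ n (f : ℕ → ℕ) → ∑< n f ≡ ∑[ i < n ] f (n ∸ suc i)
∑-reverse zero    f = refl
∑-reverse (suc n) f = begin
  ∑< n f + f n                          ≡⟨ +-comm (∑< n f) (f n) ⟩
  f n + ∑< n f                          ≡⟨ cong (f n +_) (∑-reverse n f) ⟩
  f n + ∑[ i < n ] f (n ∸ suc i)        ≡⟨ ∑-++ 1 n (λ i → f (n ∸ i)) ⟨
  ∑[ i < suc n ] f (n ∸ i)              ∎
  where open ≡-Reasoning

∑-pairing : ∀ n (f : ℕ → ℕ) c → f 0 ≡ 0 → (∀ r → 0 < r → r < n → f r + f (n ∸ r) ≡ c) →
  ∑< n f + ∑< n f ≡ c * (n ∸ 1)
∑-pairing zero    f c _      _     = sym (*-zeroʳ c)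
∑-pairing (suc n) f c f0≡0 pairs = begin
  ∑< (suc n) f + ∑< (suc n) f                                ≡⟨ cong₂ _+_ drop-f0 drop-f0 ⟩
  ∑[ i < n ] f (suc i) + ∑[ i < n ] f (suc i)                ≡⟨ cong (∑[ i < n ] f (suc i) +_) (∑-reverse n (f ∘ suc)) ⟩
  ∑[ i < n ] f (suc i) + ∑[ i < n ] f (suc (n ∸ suc i))      ≡⟨ ∑-distrib-+ n _ _ ⟨
  ∑[ i < n ] (f (suc i) + f (suc (n ∸ suc i)))               ≡⟨ ∑-cong n (λ i i<n → trans (cong (λ j → f (suc i) + f j) (complement i<n)) (pairs (suc i) z<s (s≤s i<n))) ⟩
  ∑[ _ < n ] c                                               ≡⟨ ∑-const n c ⟩
  n * c                                                      ≡⟨ *-comm n c ⟩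
  c * n                                                      ∎
  where
  open ≡-Reasoning
  drop-f0 : ∑< (suc n) f ≡ ∑[ i < n ] f (suc i)
  drop-f0 = trans (∑-++ 1 n f) (cong (_+ ∑[ i < n ] f (suc i)) f0≡0)
  complement : ∀ {i} → i < n → suc (n ∸ suc i) ≡ suc n ∸ suc i
  complement i<n = sym (+-∸-assoc 1 i<n)

𝟙 : ∀ {ℓ} {P : Set ℓ} → Dec P → ℕ
𝟙 (yes _) = 1
𝟙 (no _)  = 0

infix 3 _when_

_when_ : ∀ {ℓ} {P : Set ℓ} → ℕ → Dec P → ℕ
v when yes _ = v
v when no _  = 0

𝟙-yes : ∀ {ℓ} {P : Set ℓ} (P? : Dec P) → P → 𝟙 P? ≡ 1
𝟙-yes (yes _) p = refl
𝟙-yes (no ¬p) p = contradiction p ¬p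

𝟙-no : ∀ {ℓ} {P : Set ℓ} (P? : Dec P) → ¬ P → 𝟙 P? ≡ 0
𝟙-no (yes p) ¬p = contradiction p ¬p
𝟙-no (no _)  ¬p = refl

when-no : ∀ {ℓ} {P : Set ℓ} (P? : Dec P) v → ¬ P → (v when P?) ≡ 0
when-no (yes p) v ¬p = contradiction p ¬p
when-no (no _)  v ¬p = refl

when-cong : ∀ {ℓ} {P Q : Set ℓ} (P? : Dec P) (Q? : Dec Q) {v w : ℕ} →
  (P → Q) → (Q → P) → (P → v ≡ w) → (v when P?) ≡ (w when Q?)
when-cong (yes p) (yes _) _   _   v≡w = v≡w p
when-cong (yes p) (no ¬q) P⇒Q _   _   = contradiction (P⇒Q p) ¬q
when-cong (no ¬p) (yes q) _   Q⇒P _   = contradiction (Q⇒P q) ¬p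
when-cong (no _)  (no _)  _   _   _   = refl

∑-reindex : ∀ n (σ : ℕ → ℕ) → (∀ i → i < n → σ i < n) →
  (∀ {i j} → i < n → j < n → σ i ≡ σ j → i ≡ j) →
  (∀ j → j < n → ∃[ i ] i < n × σ i ≡ j) →
  ∀ (f : ℕ → ℕ) → ∑< n f ≡ ∑[ i < n ] f (σ i)
∑-reindex n σ σ<n σ-injective σ-surjective f = begin
  ∑[ j < n ] f j                                  ≡⟨ ∑-cong n (λ j j<n → trans (sym (+-identityʳ (f j))) (cong (_* f j) (sym (fibre-size j j<n)))) ⟩
  ∑[ j < n ] (∑[ i < n ] 𝟙 (σ i ≟ j) * f j)      ≡⟨ ∑-cong n (λ j _ → ∑-distribʳ-* n (λ i → 𝟙 (σ i ≟ j)) (f j)) ⟩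
  ∑[ j < n ] ∑[ i < n ] (𝟙 (σ i ≟ j) * f j)      ≡⟨ ∑-comm n n (λ j i → 𝟙 (σ i ≟ j) * f j) ⟩
  ∑[ i < n ] ∑[ j < n ] (𝟙 (σ i ≟ j) * f j)      ≡⟨ ∑-cong n (λ i i<n → trans (∑-single n (σ i) (σ<n i i<n) (off-diagonal i)) (diagonal i)) ⟩
  ∑[ i < n ] f (σ i)                              ∎
  where
  open ≡-Reasoning
  fibre-size : ∀ j → j < n → ∑[ i < n ] 𝟙 (σ i ≟ j) ≡ 1
  fibre-size j j<n with σ-surjective j j<n
  ... | i₀ , i₀<n , σi₀≡j = trans
    (∑-single n i₀ i₀<n λ i i<n i≢i₀ → 𝟙-no (σ i ≟ j) (λ σi≡j → i≢i₀ (σ-injective i<n i₀<n (trans σi≡j (sym σi₀≡j)))))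
    (𝟙-yes (σ i₀ ≟ j) σi₀≡j)
  off-diagonal : ∀ i j → j < n → j ≢ σ i → 𝟙 (σ i ≟ j) * f j ≡ 0
  off-diagonal i j _ j≢σi = cong (_* f j) (𝟙-no (σ i ≟ j) (j≢σi ∘ sym))
  diagonal : ∀ i → 𝟙 (σ i ≟ σ i) * f (σ i) ≡ f (σ i)
  diagonal i = trans (cong (_* f (σ i)) (𝟙-yes (σ i ≟ σ i) refl)) (+-identityʳ _)

module _ {a p} {A : Set a} {P : Pred A p} (P? : Decidable P) where

  length-filter-concatMap-upTo : ∀ n (f : ℕ → List A) →
    length (filter P? (concatMap f (upTo n))) ≡ ∑[ x < n ] length (filter P? (f x))
  length-filter-concatMap-upTo zero    f = refl
  length-filter-concatMap-upTo (suc n) f = begin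
    length (filter P? (concatMap f (upTo (suc n))))                        ≡⟨ cong (length ∘ filter P? ∘ concatMap f) (upTo-∷ʳ n) ⟨
    length (filter P? (concatMap f (upTo n List.++ [ n ])))                ≡⟨ cong (length ∘ filter P?) (concatMap-++ f (upTo n) [ n ]) ⟩
    length (filter P? (concatMap f (upTo n) List.++ (f n List.++ [])))     ≡⟨ cong length (filter-++ P? (concatMap f (upTo n)) _) ⟩
    length (filter P? (concatMap f (upTo n)) List.++ filter P? (f n List.++ []))
                                                                           ≡⟨ length-++ (filter P? (concatMap f (upTo n))) ⟩
    length (filter P? (concatMap f (upTo n))) + length (filter P? (f n List.++ []))
                                                                           ≡⟨ cong₂ _+_ (length-filter-concatMap-upTo n f) (cong (length ∘ filter P?) (++-identityʳ (f n))) ⟩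
    ∑[ x < n ] length (filter P? (f x)) + length (filter P? (f n))         ∎
    where open ≡-Reasoning

length-filter-map : ∀ {a b p} {A : Set a} {B : Set b} {P : Pred B p} (P? : Decidable P) (f : A → B) xs →
  length (filter P? (List.map f xs)) ≡ length (filter (P? ∘ f) xs)
length-filter-map P? f []       = refl
length-filter-map P? f (x ∷ xs) with does (P? (f x))
... | true  = cong suc (length-filter-map P? f xs)
... | false = length-filter-map P? f xs

length-filter-upTo : ∀ {p} {P : Pred ℕ p} (P? : Decidable P) n → length (filter P? (upTo n)) ≡ ∑[ x < n ] 𝟙 (P? x)
length-filter-upTo P? n = begin
  length (filter P? (upTo n))                         ≡⟨ cong (length ∘ filter P?) (concatMap-pure (upTo n)) ⟨
  length (filter P? (concatMap [_] (upTo n)))         ≡⟨ length-filter-concatMap-upTo P? n [_] ⟩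
  ∑[ x < n ] length (filter P? [ x ])                 ≡⟨ ∑-cong n (λ x _ → length-filter-[x] x) ⟩
  ∑[ x < n ] 𝟙 (P? x)                                 ∎
  where
  open ≡-Reasoning
  length-filter-[x] : ∀ x → length (filter P? [ x ]) ≡ 𝟙 (P? x)
  length-filter-[x] x with P? x
  ... | yes _ = refl
  ... | no _  = refl

Positive : ∀ {m} → Vec ℕ m → Set
Positive = All (0 <_)

-- Defs.d counts solutions inside the box [0, n]^m; for positive weights any larger box B gives the same count.
count : ℕ → ℕ → ∀ {m} → Vec ℕ m → ℕ
count B n {m} A = length (filter (λ x → dot A x ≟ n) (tuples m B))

count-∷ : ∀ B n {m} a (A : Vec ℕ m) → count B n (a ∷ A) ≡ ∑[ x < suc B ] (count B (n ∸ a * x) A when a * x ≤? n)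
count-∷ B n {m} a A = trans
  (length-filter-concatMap-upTo (λ xs → dot (a ∷ A) xs ≟ n) (suc B) (λ x → List.map (x ∷_) (tuples m B)))
  (∑-cong (suc B) λ x _ → trans (length-filter-map (λ xs → dot (a ∷ A) xs ≟ n) (x ∷_) (tuples m B)) (column x))
  where
  column : ∀ x → length (filter (λ ys → a * x + dot A ys ≟ n) (tuples m B)) ≡ (count B (n ∸ a * x) A when a * x ≤? n)
  column x with a * x ≤? n
  ... | yes ax≤n = cong length (filter-≐ _ _
                      ((λ eq → trans (sym (m+n∸m≡n (a * x) _)) (cong (_∸ a * x) eq)) ,
                       (λ eq → trans (cong (a * x +_) eq) (m+[n∸m]≡n ax≤n)))
                      (tuples m B))
  ... | no ax≰n  = cong length (filter-none _ (ListAll.universal (λ ys eq → ax≰n (subst (a * x ≤_) eq (m≤m+n (a * x) (dot A ys)))) (tuples m B)))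

summand-beyond : ∀ {a n x} → 0 < a → n < x → ∀ v → (v when a * x ≤? n) ≡ 0
summand-beyond {suc a} {n} {x} _ n<x v =
  when-no (suc a * x ≤? n) v λ ax≤n → <⇒≱ n<x (≤-trans (m≤m+n x (a * x)) ax≤n)

mutual
  count-≥ : ∀ {m} {A : Vec ℕ m} → Positive A → ∀ {B n} → n ≤ B → count B n A ≡ d n A
  count-≥ {A = []}    []         {B} {n} _   = refl
  count-≥ {A = a ∷ A} (a>0 ∷ A>0) {B} {n} n≤B = begin
    count B n (a ∷ A)                                           ≡⟨ count-∷ B n a A ⟩
    ∑[ x < suc B ] (count B (n ∸ a * x) A when a * x ≤? n)      ≡⟨ ∑-cong (suc B) (λ x _ → cong (_when a * x ≤? n) (count-≥ A>0 (≤-trans (m∸n≤m n (a * x)) n≤B))) ⟩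
    ∑[ x < suc B ] (d (n ∸ a * x) A when a * x ≤? n)            ≡⟨ d-∷ (a>0 ∷ A>0) (s≤s n≤B) ⟨
    d n (a ∷ A)                                                 ∎
    where open ≡-Reasoning

  d-∷ : ∀ {m a} {A : Vec ℕ m} → Positive (a ∷ A) → ∀ {n L} → n < L → d n (a ∷ A) ≡ ∑[ x < L ] (d (n ∸ a * x) A when a * x ≤? n)
  d-∷ {a = a} {A} (a>0 ∷ A>0) {n} {L} n<L = begin
    d n (a ∷ A)                                                 ≡⟨ count-∷ n n a A ⟩
    ∑[ x < suc n ] (count n (n ∸ a * x) A when a * x ≤? n)      ≡⟨ ∑-cong (suc n) (λ x _ → cong (_when a * x ≤? n) (count-≥ A>0 (m∸n≤m n (a * x)))) ⟩
    ∑[ x < suc n ] (d (n ∸ a * x) A when a * x ≤? n)            ≡⟨ ∑-vanishing-tail n<L (λ x n<x _ → summand-beyond a>0 n<x _) ⟨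
    ∑[ x < L ] (d (n ∸ a * x) A when a * x ≤? n)                ∎
    where open ≡-Reasoning

scale-positive : ∀ {m} β → 0 < β → {b : Vec ℕ m} → Positive b → Positive (map (β *_) b)
scale-positive (suc β′) _ b>0 = All.map⁺ (All.map (λ { {suc c} _ → z<s }) b>0)

d-scale : ∀ β .{{_ : NonZero β}} {m} {b : Vec ℕ m} → Positive b → ∀ q → d (β * q) (map (β *_) b) ≡ d q b
d-scale (suc β′) {b = []} [] zero    = cong (λ n → d n []) (*-zeroʳ β′)
d-scale (suc β′) {b = []} [] (suc q) = refl
d-scale β {b = c ∷ b} (c>0 ∷ b>0) q = begin
  d (β * q) (β * c ∷ map (β *_) b)                                           ≡⟨ d-∷ (scale-positive β (>-nonZero⁻¹ β) (c>0 ∷ b>0)) ≤-refl ⟩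
  ∑[ x < suc (β * q) ] (d (β * q ∸ β * c * x) (map (β *_) b) when β * c * x ≤? β * q)
                                                                             ≡⟨ ∑-cong (suc (β * q)) (λ x _ → term x) ⟩
  ∑[ x < suc (β * q) ] (d (q ∸ c * x) b when c * x ≤? q)                     ≡⟨ d-∷ (c>0 ∷ b>0) (s≤s (m≤n*m q β)) ⟨
  d q (c ∷ b)                                                                ∎
  where
  open ≡-Reasoning
  term : ∀ x → (d (β * q ∸ β * c * x) (map (β *_) b) when β * c * x ≤? β * q) ≡ (d (q ∸ c * x) b when c * x ≤? q)
  term x rewrite *-assoc β c x = when-cong (β * (c * x) ≤? β * q) (c * x ≤? q) (*-cancelˡ-≤ β) (*-monoʳ-≤ β)
    λ _ → trans (cong (λ n → d n (map (β *_) b)) (sym (*-distribˡ-∸ β q (c * x)))) (d-scale β b>0 (q ∸ c * x))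

d-scale-indivisible : ∀ β {m} {b : Vec ℕ m} → 0 < β → Positive b → ∀ {n} → ¬ β ∣ n → d n (map (β *_) b) ≡ 0
d-scale-indivisible β {b = []}    _   []          {zero}  β∤0 = contradiction (β ∣0) β∤0
d-scale-indivisible β {b = []}    _   []          {suc n} _   = refl
d-scale-indivisible β {b = c ∷ b} β>0 (c>0 ∷ b>0) {n}     β∤n =
  trans (d-∷ (scale-positive β β>0 (c>0 ∷ b>0)) ≤-refl) (∑-zero (suc n) λ x _ → term x)
  where
  term : ∀ x → (d (n ∸ β * c * x) (map (β *_) b) when β * c * x ≤? n) ≡ 0
  term x with β * c * x ≤? n
  ... | yes βcx≤n = d-scale-indivisible β β>0 b>0 λ β∣n∸βcx → β∤n (∣m∸n∣n⇒∣m β βcx≤n β∣n∸βcx (∣m⇒∣m*n x (m∣m*n c)))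
  ... | no _      = refl

divisor-<⇒≡0 : ∀ {m n} → m ∣ n → n < m → n ≡ 0
divisor-<⇒≡0 {n = zero}  _   _   = refl
divisor-<⇒≡0 {n = suc n} m∣n n<m = contradiction (∣⇒≤ m∣n) (<⇒≱ n<m)

bezout : ∀ α β .{{_ : NonZero β}} → Coprime α β → ∃[ u ] ∃[ a ] ∃[ b ] α * u + β * a ≡ 1 + β * b
bezout α β@(suc β′) α⊥β with coprime-Bézout α⊥β
... | Bézout.+- x y 1+yβ≡xα = x , 0 , y , (begin
  α * x + β * 0     ≡⟨ cong₂ _+_ (*-comm α x) (*-zeroʳ β) ⟩
  x * α + 0         ≡⟨ +-identityʳ (x * α) ⟩
  x * α             ≡⟨ 1+yβ≡xα ⟨
  1 + y * β         ≡⟨ cong suc (*-comm y β) ⟩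
  1 + β * y         ∎)
  where open ≡-Reasoning
... | Bézout.-+ x y 1+xα≡yβ = x * β′ , 1 , y * β′ , (begin
  α * (x * β′) + β * 1    ≡⟨ lhs α x β′ ⟩
  (1 + x * α) * β′ + 1    ≡⟨ cong (λ z → z * β′ + 1) 1+xα≡yβ ⟩
  y * β * β′ + 1          ≡⟨ rhs y β′ ⟩
  1 + β * (y * β′)        ∎)
  where
  open ≡-Reasoning
  lhs : ∀ α x β′ → α * (x * β′) + suc β′ * 1 ≡ (1 + x * α) * β′ + 1
  lhs = solve-∀
  rhs : ∀ y β′ → y * suc β′ * β′ + 1 ≡ 1 + suc β′ * (y * β′)
  rhs = solve-∀

module _ (α β : ℕ) .{{_ : NonZero α}} .{{_ : NonZero β}} (α⊥β : Coprime α β) where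

  private
    combination-injective-≤ : ∀ {i j a b} → i ≤ j → j < β → α * i + β * a ≡ α * j + β * b → i ≡ j × a ≡ b
    combination-injective-≤ {i} {j} {a} {b} i≤j j<β eq = i≡j , *-cancelˡ-≡ a b β βa≡βb
      where
      open ≡-Reasoning
      t : ℕ
      t = j ∸ i
      βa≡αt+βb : β * a ≡ α * t + β * b
      βa≡αt+βb = +-cancelˡ-≡ (α * i) _ _ (begin
        α * i + β * a              ≡⟨ eq ⟩
        α * j + β * b              ≡⟨ cong (λ j → α * j + β * b) (m+[n∸m]≡n i≤j) ⟨
        α * (i + t) + β * b        ≡⟨ distribute α i t β b ⟩
        α * i + (α * t + β * b)    ∎)
        where
        distribute : ∀ α i t β b → α * (i + t) + β * b ≡ α * i + (α * t + β * b)
        distribute = solve-∀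
      t≡0 : t ≡ 0
      t≡0 = divisor-<⇒≡0 β∣t (≤-<-trans (m∸n≤m j i) j<β)
        where
        β∣βb+αt : β ∣ β * b + α * t
        β∣βb+αt = subst (β ∣_) (trans βa≡αt+βb (+-comm (α * t) (β * b))) (m∣m*n a)
        β∣t : β ∣ t
        β∣t = coprime-divisor (Coprime.sym α⊥β) (∣m+n∣m⇒∣n β∣βb+αt (m∣m*n b))
      i≡j : i ≡ j
      i≡j = begin
        i          ≡⟨ +-identityʳ i ⟨
        i + 0      ≡⟨ cong (i +_) t≡0 ⟨
        i + t      ≡⟨ m+[n∸m]≡n i≤j ⟩
        j          ∎
      βa≡βb : β * a ≡ β * b
      βa≡βb = begin
        β * a              ≡⟨ βa≡αt+βb ⟩
        α * t + β * b      ≡⟨ cong (λ t → α * t + β * b) t≡0 ⟩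
        α * 0 + β * b      ≡⟨ cong (_+ β * b) (*-zeroʳ α) ⟩
        β * b              ∎

  combination-injective : ∀ {i j a b} → i < β → j < β → α * i + β * a ≡ α * j + β * b → i ≡ j × a ≡ b
  combination-injective {i} {j} i<β j<β eq with ≤-total i j
  ... | inj₁ i≤j = combination-injective-≤ i≤j j<β eq
  ... | inj₂ j≤i = Product.map sym sym (combination-injective-≤ j≤i i<β (sym eq))

  congruence-solvable : ∀ n → ∃[ r ] r < β × ∃[ a ] ∃[ b ] α * r + β * a ≡ n + β * b
  congruence-solvable n with bezout α β α⊥β
  ... | u , a , b , αu+βa≡1+βb = r , m%n<n (u * n) β , α * q + a * n , b * n , (begin
    α * r + β * (α * q + a * n)   ≡⟨ regroup α r β q a n ⟩
    α * (r + q * β) + β * a * n   ≡⟨ cong (λ m → α * m + β * a * n) (m≡m%n+[m/n]*n (u * n) β) ⟨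
    α * (u * n) + β * a * n       ≡⟨ factor α u n β a ⟩
    (α * u + β * a) * n           ≡⟨ cong (_* n) αu+βa≡1+βb ⟩
    (1 + β * b) * n               ≡⟨ expand b n β ⟩
    n + β * (b * n)               ∎)
    where
    open ≡-Reasoning
    r q : ℕ
    r = (u * n) % β
    q = (u * n) / β
    regroup : ∀ α r β q a n → α * r + β * (α * q + a * n) ≡ α * (r + q * β) + β * a * n
    regroup = solve-∀
    factor : ∀ α u n β a → α * (u * n) + β * a * n ≡ (α * u + β * a) * n
    factor = solve-∀
    expand : ∀ b n β → (1 + β * b) * n ≡ n + β * (b * n)
    expand = solve-∀

  -- Every n is α r + β N for the unique r < β with α r ≡ n (mod β) and some integer N; n ∈ ⟨α, β⟩ iff N ≥ 0.
  data Representation (n : ℕ) : Set where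
    member : ∀ r N → r < β → n ≡ α * r + β * N → Representation n
    gap    : ∀ r y → r < β → n + β * suc y ≡ α * r → Representation n

  representation : ∀ n → Representation n
  representation n with congruence-solvable n
  ... | r , r<β , a , b , αr+βa≡n+βb with b ≤? a
  ...   | yes b≤a = member r (a ∸ b) r<β (+-cancelʳ-≡ (β * b) _ _ (begin
    n + β * b                         ≡⟨ αr+βa≡n+βb ⟨
    α * r + β * a                     ≡⟨ cong (λ a → α * r + β * a) (m∸n+n≡m b≤a) ⟨
    α * r + β * (a ∸ b + b)           ≡⟨ cong (α * r +_) (*-distribˡ-+ β (a ∸ b) b) ⟩
    α * r + (β * (a ∸ b) + β * b)     ≡⟨ +-assoc (α * r) _ _ ⟨
    α * r + β * (a ∸ b) + β * b       ∎))
    where open ≡-Reasoning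
  ...   | no b≰a  = gap r y r<β (+-cancelʳ-≡ (β * a) _ _ (begin
    n + β * suc y + β * a             ≡⟨ +-assoc n _ _ ⟩
    n + (β * suc y + β * a)           ≡⟨ cong (n +_) (*-distribˡ-+ β (suc y) a) ⟨
    n + β * (suc y + a)               ≡⟨ cong (λ b → n + β * b) b≡1+y+a ⟨
    n + β * b                         ≡⟨ αr+βa≡n+βb ⟨
    α * r + β * a                     ∎))
    where
    open ≡-Reasoning
    y : ℕ
    y = b ∸ suc a
    b≡1+y+a : b ≡ suc y + a
    b≡1+y+a = trans (sym (m∸n+n≡m (≰⇒> b≰a))) (+-suc y a)

  -- The residue class of α r modulo β contains exactly k r gaps of ⟨α, β⟩, namely β q + σ r for q < k r.
  k σ : ℕ → ℕ
  k r = α * r / β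
  σ r = α * r % β

  division : ∀ r → α * r ≡ β * k r + σ r
  division r = trans (m≡m%n+[m/n]*n (α * r) β) (trans (+-comm (σ r) _) (cong (_+ σ r) (*-comm (k r) β)))

  σ<β : ∀ r → σ r < β
  σ<β r = m%n<n (α * r) β

  k<α : ∀ {r} → r < β → k r < α
  k<α r<β = m<n*o⇒m/o<n (*-monoʳ-< α r<β)

  σ-injective : ∀ {i j} → i < β → j < β → σ i ≡ σ j → i ≡ j
  σ-injective {i} {j} i<β j<β σi≡σj = proj₁ (combination-injective i<β j<β (begin
    α * i + β * k j               ≡⟨ cong (_+ β * k j) (division i) ⟩
    β * k i + σ i + β * k j       ≡⟨ cong (λ s → β * k i + s + β * k j) σi≡σj ⟩
    β * k i + σ j + β * k j       ≡⟨ swap (β * k i) (σ j) (β * k j) ⟩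
    β * k j + σ j + β * k i       ≡⟨ cong (_+ β * k i) (division j) ⟨
    α * j + β * k i               ∎))
    where
    open ≡-Reasoning
    swap : ∀ x s y → x + s + y ≡ y + s + x
    swap = solve-∀

  σ-surjective : ∀ s → s < β → ∃[ r ] r < β × σ r ≡ s
  σ-surjective s s<β with congruence-solvable s
  ... | r , r<β , a , c , αr+βa≡s+βc = r , r<β , (begin
    α * r % β                 ≡⟨ [m+kn]%n≡m%n (α * r) a β ⟨
    (α * r + a * β) % β       ≡⟨ %-congˡ (trans (cong (α * r +_) (*-comm a β)) (trans αr+βa≡s+βc (cong (s +_) (*-comm β c)))) ⟩
    (s + c * β) % β           ≡⟨ [m+kn]%n≡m%n s c β ⟩
    s % β                     ≡⟨ m<n⇒m%n≡m s<β ⟩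
    s                         ∎)
    where open ≡-Reasoning

  k-complement : ∀ {r} → 0 < r → r < β → k r + k (β ∸ r) ≡ α ∸ 1
  k-complement {r} 0<r r<β = begin
    k r + k (β ∸ r)                ≡⟨ cong (k r +_) (trans (/-congˡ α[β∸r]≡βK+[β∸σr]) (quotient-of K (∸-monoʳ-< 0<σr (<⇒≤ (σ<β r))))) ⟩
    k r + (α ∸ suc (k r))          ≡⟨ cong (k r +_) (∸-+-assoc α 1 (k r)) ⟨
    k r + (α ∸ 1 ∸ k r)            ≡⟨ m+[n∸m]≡n (∸-monoˡ-≤ 1 (k<α r<β)) ⟩
    α ∸ 1                          ∎
    where
    open ≡-Reasoning
    K : ℕ
    K = α ∸ suc (k r)
    quotient-of : ∀ q {s} → s < β → (β * q + s) / β ≡ q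
    quotient-of q {s} s<β = begin
      (β * q + s) / β          ≡⟨ /-congˡ (trans (+-comm (β * q) s) (cong (s +_) (*-comm β q))) ⟩
      (s + q * β) / β          ≡⟨ +-distrib-/-∣ʳ s (n∣m*n q) ⟩
      s / β + q * β / β        ≡⟨ cong₂ _+_ (m<n⇒m/n≡0 s<β) (m*n/n≡m q β) ⟩
      q                        ∎
    0<σr : 0 < σ r
    0<σr = n≢0⇒n>0 λ σr≡0 → <⇒≢ 0<r (sym (divisor-<⇒≡0 (coprime-divisor (Coprime.sym α⊥β)
      (divides (k r) (trans (division r) (trans (cong (β * k r +_) σr≡0) (trans (+-identityʳ _) (*-comm β (k r))))))) r<β))
    α[β∸r]≡βK+[β∸σr] : α * (β ∸ r) ≡ β * K + (β ∸ σ r)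
    α[β∸r]≡βK+[β∸σr] = begin
      α * (β ∸ r)                          ≡⟨ *-distribˡ-∸ α β r ⟩
      α * β ∸ α * r                        ≡⟨ cong₂ _∸_ αβ≡ (division r) ⟩
      β * k r + (β * K + β) ∸ (β * k r + σ r)  ≡⟨ [m+n]∸[m+o]≡n∸o (β * k r) (β * K + β) (σ r) ⟩
      β * K + β ∸ σ r                      ≡⟨ +-∸-assoc (β * K) (<⇒≤ (σ<β r)) ⟩
      β * K + (β ∸ σ r)                    ∎
      where
      expand : ∀ β κ K → (suc κ + K) * β ≡ β * κ + (β * K + β)
      expand = solve-∀
      αβ≡ : α * β ≡ β * k r + (β * K + β)
      αβ≡ = trans (cong (_* β) (sym (m+[n∸m]≡n (k<α r<β)))) (expand β (k r) K)

  ∑-k : ∑[ r < β ] k r ≡ (α ∸ 1) * (β ∸ 1) / 2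
  ∑-k = begin
    ∑< β k                                ≡⟨ m*n/n≡m (∑< β k) 2 ⟨
    ∑< β k * 2 / 2                        ≡⟨ /-congˡ (trans (*-comm (∑< β k) 2) (cong (∑< β k +_) (+-identityʳ (∑< β k)))) ⟩
    (∑< β k + ∑< β k) / 2                 ≡⟨ /-congˡ (∑-pairing β k (α ∸ 1) k0≡0 λ r 0<r r<β → k-complement 0<r r<β) ⟩
    (α ∸ 1) * (β ∸ 1) / 2                 ∎
    where
    open ≡-Reasoning
    k0≡0 : k 0 ≡ 0
    k0≡0 = trans (/-congˡ (*-zeroʳ α)) (0/n≡0 β)

  module _ {m} {b : Vec ℕ m} (b>0 : Positive b) where

    private
      βb>0 : Positive (map (β *_) b)
      βb>0 = scale-positive β (>-nonZero⁻¹ β) b>0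

      summand-indivisible : ∀ {n x} → (α * x ≤ n → ¬ β ∣ n ∸ α * x) → (d (n ∸ α * x) (map (β *_) b) when α * x ≤? n) ≡ 0
      summand-indivisible {n} {x} β∤ with α * x ≤? n
      ... | yes αx≤n = d-scale-indivisible β (>-nonZero⁻¹ β) b>0 (β∤ αx≤n)
      ... | no _     = refl

      αr≤βα : ∀ {r} → r < β → α * r ≤ β * α
      αr≤βα {r} r<β = subst (α * r ≤_) (*-comm α β) (*-monoʳ-≤ α (<⇒≤ r<β))

      quotient-form : ∀ {n x} → α * x ≤ n → β ∣ n ∸ α * x → ∃[ w ] n ≡ α * x + β * w
      quotient-form {n} {x} αx≤n (divides w n∸αx≡wβ) =
        w , trans (sym (m+[n∸m]≡n αx≤n)) (cong (α * x +_) (trans n∸αx≡wβ (*-comm w β)))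

    d-shift : ∀ {r} N → r < β → d (α * r + β * N) (α ∷ map (β *_) b) ≡ d N (α ∷ b)
    d-shift {r} N r<β = begin
      d n (α ∷ map (β *_) b)                              ≡⟨ d-∷ (>-nonZero⁻¹ α ∷ βb>0) (<-≤-trans ≤-refl (m≤n*m T β)) ⟩
      ∑[ x < β * T ] G x                                  ≡⟨ ∑-blocks β T G ⟩
      ∑[ t < T ] ∑[ j < β ] G (β * t + j)                 ≡⟨ ∑-cong T (λ t _ → ∑-single β r r<β (λ j j<β j≢r → off-residue t j<β j≢r)) ⟩
      ∑[ t < T ] G (β * t + r)                            ≡⟨ ∑-cong T (λ t _ → on-residue t) ⟩
      ∑[ t < T ] (d (N ∸ α * t) b when α * t ≤? N)        ≡⟨ d-∷ (>-nonZero⁻¹ α ∷ b>0) (s≤s N≤n) ⟨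
      d N (α ∷ b)                                         ∎
      where
      open ≡-Reasoning
      n T : ℕ
      n = α * r + β * N
      T = suc n
      G : ℕ → ℕ
      G x = d (n ∸ α * x) (map (β *_) b) when α * x ≤? n
      N≤n : N ≤ n
      N≤n = ≤-trans (m≤n*m N β) (m≤n+m (β * N) (α * r))
      regroup : ∀ α β t j w → α * (β * t + j) + β * w ≡ α * j + β * (α * t + w)
      regroup = solve-∀
      off-residue : ∀ t {j} → j < β → j ≢ r → G (β * t + j) ≡ 0
      off-residue t {j} j<β j≢r = summand-indivisible λ αx≤n β∣ → case quotient-form αx≤n β∣ of λ
        { (w , n≡αx+βw) → j≢r (proj₁ (combination-injective j<β r<β (trans (sym (regroup α β t j w)) (sym n≡αx+βw)))) }
      on-residue : ∀ t → G (β * t + r) ≡ (d (N ∸ α * t) b when α * t ≤? N)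
      on-residue t = when-cong (α * (β * t + r) ≤? n) (α * t ≤? N)
        (λ le → *-cancelˡ-≤ β (+-cancelˡ-≤ (α * r) _ _ (subst (_≤ n) αx≡ le)))
        (λ le → subst (_≤ n) (sym αx≡) (+-monoʳ-≤ (α * r) (*-monoʳ-≤ β le)))
        (λ _ → trans (cong (λ m → d m (map (β *_) b)) n∸αx≡) (d-scale β b>0 (N ∸ α * t)))
        where
        spread : ∀ α β t r → α * (β * t + r) ≡ α * r + β * (α * t)
        spread = solve-∀
        αx≡ : α * (β * t + r) ≡ α * r + β * (α * t)
        αx≡ = spread α β t r
        n∸αx≡ : n ∸ α * (β * t + r) ≡ β * (N ∸ α * t)
        n∸αx≡ = trans (cong (n ∸_) αx≡) (trans ([m+n]∸[m+o]≡n∸o (α * r) (β * N) (β * (α * t))) (sym (*-distribˡ-∸ β N (α * t))))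

    -- A solution with α-coordinate x would give α (x % β) + β (1 + …) = α r + β 0, against uniqueness.
    d-gap : ∀ {n r y} → r < β → n + β * suc y ≡ α * r → d n (α ∷ map (β *_) b) ≡ 0
    d-gap {n} {r} {y} r<β n+β[1+y]≡αr =
      trans (d-∷ (>-nonZero⁻¹ α ∷ βb>0) ≤-refl) (∑-zero (suc n) λ x _ → summand-indivisible λ αx≤n β∣ → case quotient-form αx≤n β∣ of λ
        { (w , n≡αx+βw) → 1+n≢0 (proj₂ (combination-injective (m%n<n x β) r<β (lift x w n≡αx+βw))) })
      where
      open ≡-Reasoning
      regroup : ∀ α β s q w y → α * s + β * suc (α * q + w + y) ≡ α * (s + q * β) + β * w + β * suc y
      regroup = solve-∀
      lift : ∀ x w → n ≡ α * x + β * w → α * (x % β) + β * suc (α * (x / β) + w + y) ≡ α * r + β * 0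
      lift x w n≡αx+βw = begin
        α * (x % β) + β * suc (α * (x / β) + w + y)       ≡⟨ regroup α β (x % β) (x / β) w y ⟩
        α * (x % β + x / β * β) + β * w + β * suc y       ≡⟨ cong (λ x → α * x + β * w + β * suc y) (m≡m%n+[m/n]*n x β) ⟨
        α * x + β * w + β * suc y                         ≡⟨ cong (_+ β * suc y) n≡αx+βw ⟨
        n + β * suc y                                     ≡⟨ n+β[1+y]≡αr ⟩
        α * r                                             ≡⟨ +-identityʳ (α * r) ⟨
        α * r + 0                                         ≡⟨ cong (α * r +_) (*-zeroʳ β) ⟨
        α * r + β * 0                                     ∎

    d-class-gap : ∀ {r q} → r < β → q < k r → d (β * q + σ r) (α ∷ map (β *_) b) ≡ 0
    d-class-gap {r} {q} r<β q<kr = d-gap r<β (begin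
      β * q + σ r + β * suc (k r ∸ suc q)    ≡⟨ cong (λ t → β * q + σ r + β * t) (+-∸-assoc 1 q<kr) ⟨
      β * q + σ r + β * (k r ∸ q)            ≡⟨ regroup β q (σ r) (k r ∸ q) ⟩
      β * (q + (k r ∸ q)) + σ r              ≡⟨ cong (λ t → β * t + σ r) (m+[n∸m]≡n (<⇒≤ q<kr)) ⟩
      β * k r + σ r                          ≡⟨ division r ⟨
      α * r                                  ∎)
      where
      open ≡-Reasoning
      regroup : ∀ β q s t → β * q + s + β * t ≡ β * (q + t) + s
      regroup = solve-∀

    d-class-member : ∀ {r} i → r < β → d (β * (k r + i) + σ r) (α ∷ map (β *_) b) ≡ d i (α ∷ b)
    d-class-member {r} i r<β = trans (cong (λ n → d n (α ∷ map (β *_) b)) shifted) (d-shift i r<β)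
      where
      regroup : ∀ β k i s → β * (k + i) + s ≡ β * k + s + β * i
      regroup = solve-∀
      shifted : β * (k r + i) + σ r ≡ α * r + β * i
      shifted = trans (regroup β (k r) i (σ r)) (cong (_+ β * i) (sym (division r)))

    threshold-shift : ∀ {p B} → (∀ n → B ≤ n → p < d n (α ∷ b)) → ∀ n → β * (B + α) ≤ n → p < d n (α ∷ map (β *_) b)
    threshold-shift {p} {B} B-bound n β[B+α]≤n with representation n
    ... | member r N r<β refl = subst (p <_) (sym (d-shift N r<β)) (B-bound N B≤N)
      where
      βB+βα≤βN+βα : β * B + β * α ≤ β * N + β * α
      βB+βα≤βN+βα = begin
        β * B + β * α    ≡⟨ *-distribˡ-+ β B α ⟨
        β * (B + α)      ≤⟨ β[B+α]≤n ⟩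
        α * r + β * N    ≡⟨ +-comm (α * r) (β * N) ⟩
        β * N + α * r    ≤⟨ +-monoʳ-≤ (β * N) (αr≤βα r<β) ⟩
        β * N + β * α    ∎
        where open ≤-Reasoning
      B≤N : B ≤ N
      B≤N = *-cancelˡ-≤ β (+-cancelʳ-≤ (β * α) _ _ βB+βα≤βN+βα)
    ... | gap r y r<β n+β[1+y]≡αr = contradiction β[B+α]≤n (<⇒≱ (begin-strict
      n                <⟨ m<m+n n (>-nonZero⁻¹ β) ⟩
      n + β            ≤⟨ +-monoʳ-≤ n (m≤m*n β (suc y)) ⟩
      n + β * suc y    ≡⟨ n+β[1+y]≡αr ⟩
      α * r            ≤⟨ αr≤βα r<β ⟩
      β * α            ≤⟨ *-monoʳ-≤ β (m≤n+m α B) ⟩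
      β * (B + α)      ∎))
      where open ≤-Reasoning

    genus-shift : ∀ {p c} → IsPGenus p (α ∷ b) c → IsPGenus p (α ∷ map (β *_) b) (β * c + (α ∸ 1) * (β ∸ 1) / 2)
    genus-shift {p} {c} (B , B-bound , c≡) = β * M , threshold-shift B-bound , sym count′
      where
      open ≡-Reasoning
      M : ℕ
      M = B + α
      F F′ : ℕ → ℕ
      F n = 𝟙 (d n (α ∷ b) ≤? p)
      F′ n = 𝟙 (d n (α ∷ map (β *_) b) ≤? p)

      per-class : ∀ {r} → r < β → ∑[ q < M ] F′ (β * q + σ r) ≡ k r + c
      per-class {r} r<β = begin
        ∑[ q < M ] F′ (β * q + σ r)                                    ≡⟨ cong (λ l → ∑[ q < l ] F′ (β * q + σ r)) (m+[n∸m]≡n kr≤M) ⟨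
        ∑[ q < k r + (M ∸ k r) ] F′ (β * q + σ r)                      ≡⟨ ∑-++ (k r) (M ∸ k r) _ ⟩
        ∑[ q < k r ] F′ (β * q + σ r) + ∑[ i < M ∸ k r ] F′ (β * (k r + i) + σ r)
                                                                       ≡⟨ cong₂ _+_ gaps members ⟩
        k r + c                                                        ∎
        where
        kr≤M : k r ≤ M
        kr≤M = ≤-trans (<⇒≤ (k<α r<β)) (m≤n+m α B)
        gaps : ∑[ q < k r ] F′ (β * q + σ r) ≡ k r
        gaps = begin
          ∑[ q < k r ] F′ (β * q + σ r)    ≡⟨ ∑-cong (k r) (λ q q<kr → 𝟙-yes (_ ≤? p) (subst (_≤ p) (sym (d-class-gap r<β q<kr)) z≤n)) ⟩
          ∑[ _ < k r ] 1                   ≡⟨ ∑-const (k r) 1 ⟩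
          k r * 1                          ≡⟨ *-identityʳ (k r) ⟩
          k r                              ∎
        members : ∑[ i < M ∸ k r ] F′ (β * (k r + i) + σ r) ≡ c
        members = begin
          ∑[ i < M ∸ k r ] F′ (β * (k r + i) + σ r)      ≡⟨ ∑-cong (M ∸ k r) (λ i _ → cong (λ m → 𝟙 (m ≤? p)) (d-class-member i r<β)) ⟩
          ∑[ i < M ∸ k r ] F i                           ≡⟨ ∑-vanishing-tail B≤M∸kr (λ i B≤i _ → 𝟙-no (_ ≤? p) (<⇒≱ (B-bound i B≤i))) ⟩
          ∑[ i < B ] F i                                 ≡⟨ trans c≡ (length-filter-upTo (λ n → d n (α ∷ b) ≤? p) B) ⟨
          c                                              ∎
          where
          B≤M∸kr : B ≤ M ∸ k r
          B≤M∸kr = subst (B ≤_) (sym (+-∸-assoc B (<⇒≤ (k<α r<β)))) (m≤m+n B (α ∸ k r))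

      count′ : length (filter (λ n → d n (α ∷ map (β *_) b) ≤? p) (upTo (β * M))) ≡ β * c + (α ∸ 1) * (β ∸ 1) / 2
      count′ = begin
        length (filter (λ n → d n (α ∷ map (β *_) b) ≤? p) (upTo (β * M)))
                                                              ≡⟨ length-filter-upTo (λ n → d n (α ∷ map (β *_) b) ≤? p) (β * M) ⟩
        ∑[ n < β * M ] F′ n                                   ≡⟨ ∑-blocks β M F′ ⟩
        ∑[ q < M ] ∑[ s < β ] F′ (β * q + s)                  ≡⟨ ∑-cong M (λ q _ → ∑-reindex β σ (λ r _ → σ<β r) σ-injective σ-surjective (λ s → F′ (β * q + s))) ⟩
        ∑[ q < M ] ∑[ r < β ] F′ (β * q + σ r)                ≡⟨ ∑-comm M β (λ q r → F′ (β * q + σ r)) ⟩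
        ∑[ r < β ] ∑[ q < M ] F′ (β * q + σ r)                ≡⟨ ∑-cong β (λ r r<β → per-class r<β) ⟩
        ∑[ r < β ] (k r + c)                                  ≡⟨ ∑-distrib-+ β k (λ _ → c) ⟩
        ∑< β k + ∑[ _ < β ] c                                 ≡⟨ cong₂ _+_ ∑-k (∑-const β c) ⟩
        (α ∸ 1) * (β ∸ 1) / 2 + β * c                         ≡⟨ +-comm _ (β * c) ⟩
        β * c + (α ∸ 1) * (β ∸ 1) / 2                         ∎

    private
      β∸1<β : β ∸ 1 < β
      β∸1<β = ∸-monoʳ-< z<s (>-nonZero⁻¹ β)

      αr≤[β∸1]α : ∀ {r} → r < β → α * r ≤ (β ∸ 1) * α
      αr≤[β∸1]α {r} r<β = subst (α * r ≤_) (*-comm α (β ∸ 1)) (*-monoʳ-≤ α (∸-monoˡ-≤ 1 r<β))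

      gap-bound : ∀ {n r y} → r < β → n + β * suc y ≡ α * r → n + β ≤ (β ∸ 1) * α
      gap-bound {n} {r} {y} r<β n+β[1+y]≡αr = begin
        n + β                  ≤⟨ +-monoʳ-≤ n (m≤m*n β (suc y)) ⟩
        n + β * suc y          ≡⟨ n+β[1+y]≡αr ⟩
        α * r                  ≤⟨ αr≤[β∸1]α r<β ⟩
        (β ∸ 1) * α            ∎
        where open ≤-Reasoning

      top-member : ∀ N → β * N + (β ∸ 1) * α ≡ α * (β ∸ 1) + β * N
      top-member N = trans (+-comm (β * N) _) (cong (_+ β * N) (*-comm (β ∸ 1) α))

    -- Data.Integer is opened only here: its prefix +_ makes every section (x +_) on ℕ ambiguous.
    module _ where
      open import Data.Integer as ℤ using (ℤ; +_; -[1+_]; _⊖_) renaming (_+_ to _+ℤ_; _*_ to _*ℤ_; _≤_ to _≤ℤ_)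
      import Data.Integer.Properties as ℤ

      frobenius-shift : ∀ {p g} → IsPFrobenius p (α ∷ b) g →
        IsPFrobenius p (α ∷ map (β *_) b) ((+ β) *ℤ g +ℤ (+ ((β ∸ 1) * α)))
      frobenius-shift {p} (g-max , inj₂ (G , refl , dG≤p)) =
        subst (IsPFrobenius p (α ∷ map (β *_) b)) (sym g′≡) (g′-max , inj₂ (β * G + m′ , refl , dg′≤p))
        where
        m′ : ℕ
        m′ = (β ∸ 1) * α
        g′≡ : (+ β) *ℤ (+ G) +ℤ (+ m′) ≡ + (β * G + m′)
        g′≡ = trans (cong (_+ℤ + m′) (sym (ℤ.pos-* β G))) (sym (ℤ.pos-+ (β * G) m′))
        g′-max : ∀ n → d n (α ∷ map (β *_) b) ≤ p → + n ≤ℤ + (β * G + m′)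
        g′-max n dn≤p with representation n
        ... | member r N r<β refl = ℤ.+≤+ (subst (_≤ β * G + m′) (+-comm (β * N) (α * r)) (+-mono-≤ (*-monoʳ-≤ β N≤G) (αr≤[β∸1]α r<β)))
          where
          N≤G : N ≤ G
          N≤G = ℤ.drop‿+≤+ (g-max N (subst (_≤ p) (d-shift N r<β) dn≤p))
        ... | gap r y r<β n+β[1+y]≡αr = ℤ.+≤+ (≤-trans (m≤m+n n β) (≤-trans (gap-bound r<β n+β[1+y]≡αr) (m≤n+m m′ (β * G))))
        dg′≤p : d (β * G + m′) (α ∷ map (β *_) b) ≤ p
        dg′≤p = subst (_≤ p) (sym (trans (cong (λ n → d n (α ∷ map (β *_) b)) (top-member G)) (d-shift G β∸1<β))) dG≤p
      frobenius-shift {p} (g-max , inj₁ refl) =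
        subst (IsPFrobenius p (α ∷ map (β *_) b)) (sym g′≡) (g′-max , g′-attained)
        where
        m′ : ℕ
        m′ = (β ∸ 1) * α
        g′≡ : (+ β) *ℤ -[1+ 0 ] +ℤ (+ m′) ≡ m′ ⊖ β
        g′≡ = trans (cong (_+ℤ + m′) (trans (ℤ.*-comm (+ β) -[1+ 0 ]) (ℤ.-1*i≡-i (+ β)))) (ℤ.-m+n≡n⊖m β m′)
        g′-max : ∀ n → d n (α ∷ map (β *_) b) ≤ p → + n ≤ℤ m′ ⊖ β
        g′-max n dn≤p with representation n
        ... | member r N r<β refl = contradiction (g-max N (subst (_≤ p) (d-shift N r<β) dn≤p)) λ ()
        ... | gap r y r<β n+β[1+y]≡αr =
          subst (+ n ≤ℤ_) (sym (ℤ.⊖-≥ (≤-trans (m≤n+m β n) n+β≤m′))) (ℤ.+≤+ (m+n≤o⇒m≤o∸n n n+β≤m′))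
          where
          n+β≤m′ : n + β ≤ m′
          n+β≤m′ = gap-bound r<β n+β[1+y]≡αr
        g′-attained : (m′ ⊖ β ≡ -[1+ 0 ]) ⊎ (Σ ℕ λ n → (m′ ⊖ β ≡ + n) × (d n (α ∷ map (β *_) b) ≤ p))
        g′-attained with β ≤? m′
        ... | yes β≤m′ = inj₂ (m′ ∸ β , ℤ.⊖-≥ β≤m′ , subst (_≤ p) (sym (d-gap β∸1<β m′∸β+β≡α[β∸1])) z≤n)
          where
          m′∸β+β≡α[β∸1] : m′ ∸ β + β * 1 ≡ α * (β ∸ 1)
          m′∸β+β≡α[β∸1] = trans (cong (λ x → m′ ∸ β + x) (*-identityʳ β)) (trans (m∸n+n≡m β≤m′) (*-comm (β ∸ 1) α))
        ... | no β≰m′ = inj₁ (trans (ℤ.⊖-< m′<β) (cong (λ k → ℤ.- (+ k)) β∸m′≡1))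
          where
          m′<β : m′ < β
          m′<β = ≰⇒> β≰m′
          m′≡β∸1 : m′ ≡ β ∸ 1
          m′≡β∸1 = ≤-antisym (∸-monoˡ-≤ 1 m′<β) (m≤m*n (β ∸ 1) α)
          β∸m′≡1 : β ∸ m′ ≡ 1
          β∸m′≡1 = trans (cong (β ∸_) m′≡β∸1) (m∸[m∸n]≡n (>-nonZero⁻¹ β))

open import Data.Integer using (ℤ; +_) renaming (_+_ to _+ℤ_; _*_ to _*ℤ_)

proposition1 : (p k : ℕ) (b : Vec ℕ (suc k)) (α β : ℕ) →
  (∀ (i : Fin (suc k)) → 0 < lookup b i) →
  gcdVec b ≡ 1 →
  (∀ (i : Fin (suc k)) → ¬ InSemigroup (lookup b i) (removeAt b i)) →
  0 < α → InSemigroup α b → (∀ (i : Fin (suc k)) → α ≢ lookup b i) →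
  0 < β → gcd α β ≡ 1 →
  (∀ (g : ℤ) → IsPFrobenius p (α ∷ b) g →
     IsPFrobenius p (α ∷ map (β *_) b)
       ((+ β) *ℤ g +ℤ (+ ((β ∸ 1) * α)))) ×
  (∀ (c : ℕ) → IsPGenus p (α ∷ b) c →
     IsPGenus p (α ∷ map (β *_) b)
       (β * c + ((α ∸ 1) * (β ∸ 1)) / 2))
proposition1 p k b α β b>0 _ _ α>0 _ _ β>0 gcd[α,β]≡1 =
  (λ _ → frobenius-shift α β α⊥β b>0′) , (λ _ → genus-shift α β α⊥β b>0′)
  where
  instance
    α≢0 : NonZero α
    α≢0 = >-nonZero α>0
    β≢0 : NonZero β
    β≢0 = >-nonZero β>0
  α⊥β : Coprime α β
  α⊥β = gcd≡1⇒coprime gcd[α,β]≡1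
  b>0′ : Positive b
  b>0′ = All.lookup⁻ b>0
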